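{- Let $V\subseteq\mathbb{P}$ and $\phi_0\in\mathcal{L}^{ -*}$. If there is no closed tableau for $(V,\phi_0)$, then $V\models\phi_0$.
   Context: $\mathsf{DL\text{ - }PA}$: $\mathbb{P}$ is a countable set of propositional variables; an assignment $\alpha$ is a non-empty finite partial function $\mathbb{P}\to\{\top,\bot\}$ with domain $\mathrm{dom}(\alpha)$. Formulas $\phi ::= p \mid \neg\phi \mid \phi\wedge\phi \mid [\pi]\phi$, programs $\pi ::= \alpha \mid \pi;\pi \mid \pi\cup\pi \mid \pi^* \mid \phi?$; $\mathcal{L}$ is the set of formulas, $\mathcal{L}^{ -*}$ those without ${}^*$. A model is $V\subseteq\mathbb{P}$; $V^\alpha=\{p\in V:p\notin\mathrm{dom}(\alpha)\}\cup\{p\in\mathrm{dom}(\alpha):\alpha(p)=\top\}$. Semantics: $V\models p$ iff $p\in V$; $\neg,\wedge$ classical; $V\models[\pi]\phi$ iff $V'\models\phi$ for all $(V,V')\in R_\pi$, where $R_\alpha=\{(V,V^\alpha)\}$, $R_{\pi_1;\pi_2}=R_{\pi_1}\circ R_{\pi_2}$ (first $\pi_1$ then $\pi_2$), $R_{\pi_1\cup\pi_2}=R_{\pi_1}\cup R_{\pi_2}$, $R_{\pi^*}$ the reflexive–transitive closure of $R_\pi$, $R_{\phi?}=\{(V,V):V\models\phi\}$. $\mathbb{P}_{\phi_0}$ denotes the set of propositional variables occurring in $\phi_0$ (including those in domains of assignments occurring in $\phi_0$). Tableaux: a labelled formula is a pair $\langle\sigma,\phi\rangle$ with $\sigma$ a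 (possibly empty) finite sequence of assignments and $\phi\in\mathcal{L}$; a branch is a set of labelled formulas. The initial branch for $(V,\phi_0)$ is $b_0=\{\langle(),p\rangle:p\in\mathbb{P}_{\phi_0}\cap V\}\cup\{\langle(),\neg p\rangle:p\in\mathbb{P}_{\phi_0}\setminus V\}\cup\{\langle(),\phi_0\rangle\}$. A tableau for $(V,\phi_0)$ is a set of branches that is either $\{b_0\}$ or of the form $(T'\setminus\{b\})\cup\{b\cup b_1,\dots,b\cup b_k\}$ where $T'$ is a tableau for $(V,\phi_0)$, $b\in T'$, and $b_1,\dots,b_k$ are generated by one of the following rules applied to $b$: R$\neg$: $\langle\sigma,\neg\neg\phi\rangle\in b$ gives $k=1$, $b_1=\{\langle\sigma,\phi\rangle\}$. R$\wedge$: $\langle\sigma,\phi\wedge\psi\rangle\in b$ gives $k=1$, $b_1=\{\langle\sigma,\phi\rangle,\langle\sigma,\psi\rangle\}$. R$\vee$: $\langle\sigma,\neg(\phi\wedge\psi)\rangle\in b$ gives $k=2$, $b_1=\{\langle\sigma,\neg\phi\rangle\}$, $b_2=\{\langle\sigma,\neg\psi\rangle\}$. R$[\alpha]$: $\langle\sigma,[\alpha]\phi\rangle\in b$ gives $k=1$, $b_1=\{\langle\sigma\alpha,\phi\rangle\}\cup\{\langle\sigma\alpha,p\rangle:\alpha(p)=\top\}\cup\{\langle\sigma\alpha,\neg p\rangle:\alpha(p)=\bot\}$. R$\langle\alpha\rangle$: $\langle\sigma,\neg[\alpha]\phi\rangle\in b$ gives $k=1$, $b_1=\{\langle\sigma\alpha,\neg\phi\rangle\}\cup\{\langle\sigma\alpha,p\rangle:\alpha(p)=\top\}\cup\{\langle\sigma\alpha,\neg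 p\rangle:\alpha(p)=\bot\}$. R$[?]$: $\langle\sigma,[\psi?]\phi\rangle\in b$ gives $k=2$, $b_1=\{\langle\sigma,\neg\psi\rangle\}$, $b_2=\{\langle\sigma,\phi\rangle\}$. R$\langle?\rangle$: $\langle\sigma,\neg[\psi?]\phi\rangle\in b$ gives $k=1$, $b_1=\{\langle\sigma,\psi\rangle,\langle\sigma,\neg\phi\rangle\}$. R$[;]$: $\langle\sigma,[\pi_1;\pi_2]\phi\rangle\in b$ gives $k=1$, $b_1=\{\langle\sigma,[\pi_1][\pi_2]\phi\rangle\}$. R$\langle;\rangle$: $\langle\sigma,\neg[\pi_1;\pi_2]\phi\rangle\in b$ gives $k=1$, $b_1=\{\langle\sigma,\neg[\pi_1][\pi_2]\phi\rangle\}$. R$[\cup]$: $\langle\sigma,[\pi_1\cup\pi_2]\phi\rangle\in b$ gives $k=1$, $b_1=\{\langle\sigma,[\pi_1]\phi\rangle,\langle\sigma,[\pi_2]\phi\rangle\}$. R$\langle\cup\rangle$: $\langle\sigma,\neg[\pi_1\cup\pi_2]\phi\rangle\in b$ gives $k=2$, $b_1=\{\langle\sigma,\neg[\pi_1]\phi\rangle\}$, $b_2=\{\langle\sigma,\neg[\pi_2]\phi\rangle\}$. RP1: $\langle\sigma,p\rangle,\langle\sigma\alpha,\psi\rangle\in b$ for some $\psi$ with $p\notin\mathrm{dom}(\alpha)$ gives $k=1$, $b_1=\{\langle\sigma\alpha,p\rangle\}$. RP2: $\langle\sigma,\neg p\rangle,\langle\sigma\alpha,\psi\rangle\in b$ for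 some $\psi$ with $p\notin\mathrm{dom}(\alpha)$ gives $k=1$, $b_1=\{\langle\sigma\alpha,\neg p\rangle\}$. A branch is closed iff it is blatantly inconsistent, i.e. contains both $\langle\sigma,\phi\rangle$ and $\langle\sigma,\neg\phi\rangle$ for some $\sigma,\phi$. A tableau is closed iff all its branches are closed. -}

module Defs where

open import Data.Nat using (ℕ; _<_; _≟_)
open import Data.Bool using (Bool; true; false; if_then_else_)
open import Data.Product using (_×_; _,_; proj₁; proj₂; Σ; ∃)
open import Data.List using (List; []; _∷_; _++_; map; [_])
open import Data.List.Membership.Propositional using (_∈_; _∉_)
open import Data.List.Relation.Unary.All using (All)
open import Data.Maybe using (Maybe; just; nothing)
open import Data.Unit using (⊤)
open import Data.Sum using (_⊎_)
open import Data.Empty using (⊥)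
open import Relation.Nullary using (¬_; yes; no)
open import Relation.Binary.PropositionalEquality using (_≡_)
open import Relation.Binary.Construct.Closure.ReflexiveTransitive using (Star)

Var : Set
Var = ℕ

-- Keys of an entry list are strictly increasing (canonical form of a
-- finite partial function; guarantees functionality and that two lists
-- represent the same partial function iff they are equal).
Increasing : List (Var × Bool) → Set
Increasing []            = ⊤
Increasing (x ∷ [])      = ⊤
Increasing (x ∷ y ∷ l)   = (proj₁ x < proj₁ y) × Increasing (y ∷ l)

NonEmpty : List (Var × Bool) → Set
NonEmpty []      = ⊥
NonEmpty (_ ∷ _) = ⊤

-- An assignment: a non-empty finite partial function ℙ → {⊤,⊥},
-- given by its graph listed in increasing order of variables.
record Assignment : Set where
  constructor mkAsg
  field
    entries     : List (Var × Bool)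
    .nonEmpty   : NonEmpty entries
    .increasing : Increasing entries
open Assignment public

InDom : Var → Assignment → Set
InDom p α = ∃ λ b → (p , b) ∈ entries α

lookupE : Var → List (Var × Bool) → Maybe Bool
lookupE p []              = nothing
lookupE p ((q , b) ∷ l) with p ≟ q
... | yes _ = just b
... | no  _ = lookupE p l

mutual
  data Formula : Set where
    var  : Var → Formula
    ¬'_  : Formula → Formula
    _∧'_ : Formula → Formula → Formula
    ⟦_⟧_ : Program → Formula → Formula

  data Program : Set where
    asg  : Assignment → Program
    _⨟_  : Program → Program → Program
    _∪'_ : Program → Program → Program
    _*   : Program → Program
    _¿   : Formula → Program

mutual
  StarFree : Formula → Set
  StarFree (var p)   = ⊤
  StarFree (¬' φ)    = StarFree φ
  StarFree (φ ∧' ψ)  = StarFree φ × StarFree ψ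
  StarFree (⟦ π ⟧ φ) = StarFreeP π × StarFree φ

  StarFreeP : Program → Set
  StarFreeP (asg α)    = ⊤
  StarFreeP (π₁ ⨟ π₂)  = StarFreeP π₁ × StarFreeP π₂
  StarFreeP (π₁ ∪' π₂) = StarFreeP π₁ × StarFreeP π₂
  StarFreeP (π *)      = ⊥
  StarFreeP (φ ¿)      = StarFree φ

mutual
  vars : Formula → List Var
  vars (var p)   = p ∷ []
  vars (¬' φ)    = vars φ
  vars (φ ∧' ψ)  = vars φ ++ vars ψ
  vars (⟦ π ⟧ φ) = varsP π ++ vars φ

  varsP : Program → List Var
  varsP (asg α)    = map proj₁ (entries α)
  varsP (π₁ ⨟ π₂)  = varsP π₁ ++ varsP π₂
  varsP (π₁ ∪' π₂) = varsP π₁ ++ varsP π₂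
  varsP (π *)      = varsP π
  varsP (φ ¿)      = vars φ

-- Semantics. A model V ⊆ ℙ is given by its characteristic function.

Model : Set
Model = Var → Bool

update : Model → Assignment → Model
update V α p with lookupE p (entries α)
... | just b  = b
... | nothing = V p

mutual
  infix 4 _⊨_
  _⊨_ : Model → Formula → Set
  V ⊨ var p     = V p ≡ true
  V ⊨ (¬' φ)    = ¬ (V ⊨ φ)
  V ⊨ (φ ∧' ψ)  = (V ⊨ φ) × (V ⊨ ψ)
  V ⊨ (⟦ π ⟧ φ) = ∀ V' → R π V V' → V' ⊨ φ

  R : Program → Model → Model → Set
  R (asg α)    V V' = V' ≡ update V α
  R (π₁ ⨟ π₂)  V V' = ∃ λ W → R π₁ V W × R π₂ W V'
  R (π₁ ∪' π₂) V V' = R π₁ V V' ⊎ R π₂ V V'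
  R (π *)      V V' = Star (R π) V V'
  R (φ ¿)      V V' = (V' ≡ V) × (V ⊨ φ)

-- labels: finite sequences of assignments; σα is  σ ++ [ α ]
Label : Set
Label = List Assignment

LFormula : Set
LFormula = Label × Formula

-- A branch is a (finite) set of labelled formulas, represented as a list
-- (only membership matters); b ∪ b₁ is b ++ b₁.
Branch : Set
Branch = List LFormula

effects : Label → Assignment → Branch
effects σ α = map (λ e → (σ ++ [ α ]) , lit e) (entries α)
  where
  lit : Var × Bool → Formula
  lit (p , true)  = var p
  lit (p , false) = ¬' var p

-- Rule b bs : applying a rule to b generates the branches b₁,…,b_k = bs
data Rule (b : Branch) : List Branch → Set where
  R¬    : ∀ {σ φ} → (σ , ¬' ¬' φ) ∈ b → Rule b [ [ (σ , φ) ] ]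
  R∧    : ∀ {σ φ ψ} → (σ , φ ∧' ψ) ∈ b → Rule b [ (σ , φ) ∷ (σ , ψ) ∷ [] ]
  R∨    : ∀ {σ φ ψ} → (σ , ¬' (φ ∧' ψ)) ∈ b →
          Rule b ([ (σ , ¬' φ) ] ∷ [ (σ , ¬' ψ) ] ∷ [])
  R[α]  : ∀ {σ α φ} → (σ , ⟦ asg α ⟧ φ) ∈ b →
          Rule b [ ((σ ++ [ α ]) , φ) ∷ effects σ α ]
  R⟨α⟩  : ∀ {σ α φ} → (σ , ¬' (⟦ asg α ⟧ φ)) ∈ b →
          Rule b [ ((σ ++ [ α ]) , ¬' φ) ∷ effects σ α ]
  R[?]  : ∀ {σ ψ φ} → (σ , ⟦ ψ ¿ ⟧ φ) ∈ b →
          Rule b ([ (σ , ¬' ψ) ] ∷ [ (σ , φ) ] ∷ [])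
  R⟨?⟩  : ∀ {σ ψ φ} → (σ , ¬' (⟦ ψ ¿ ⟧ φ)) ∈ b →
          Rule b [ (σ , ψ) ∷ (σ , ¬' φ) ∷ [] ]
  R[⨟]  : ∀ {σ π₁ π₂ φ} → (σ , ⟦ π₁ ⨟ π₂ ⟧ φ) ∈ b →
          Rule b [ [ (σ , ⟦ π₁ ⟧ ⟦ π₂ ⟧ φ) ] ]
  R⟨⨟⟩  : ∀ {σ π₁ π₂ φ} → (σ , ¬' (⟦ π₁ ⨟ π₂ ⟧ φ)) ∈ b →
          Rule b [ [ (σ , ¬' (⟦ π₁ ⟧ ⟦ π₂ ⟧ φ)) ] ]
  R[∪]  : ∀ {σ π₁ π₂ φ} → (σ , ⟦ π₁ ∪' π₂ ⟧ φ) ∈ b →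
          Rule b [ (σ , ⟦ π₁ ⟧ φ) ∷ (σ , ⟦ π₂ ⟧ φ) ∷ [] ]
  R⟨∪⟩  : ∀ {σ π₁ π₂ φ} → (σ , ¬' (⟦ π₁ ∪' π₂ ⟧ φ)) ∈ b →
          Rule b ([ (σ , ¬' (⟦ π₁ ⟧ φ)) ] ∷ [ (σ , ¬' (⟦ π₂ ⟧ φ)) ] ∷ [])
  RP1   : ∀ {σ α p ψ} → (σ , var p) ∈ b → ((σ ++ [ α ]) , ψ) ∈ b →
          ¬ InDom p α → Rule b [ [ ((σ ++ [ α ]) , var p) ] ]
  RP2   : ∀ {σ α p ψ} → (σ , ¬' var p) ∈ b → ((σ ++ [ α ]) , ψ) ∈ b →
          ¬ InDom p α → Rule b [ [ ((σ ++ [ α ]) , ¬' var p) ] ]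

initBranch : Model → Formula → Branch
initBranch V φ₀ = map lit (vars φ₀) ++ [ ([] , φ₀) ]
  where
  lit : Var → LFormula
  lit p = [] , (if V p then var p else ¬' var p)

data Tableau (V : Model) (φ₀ : Formula) : List Branch → Set where
  init : Tableau V φ₀ [ initBranch V φ₀ ]
  step : ∀ {xs ys b bs} → Tableau V φ₀ (xs ++ b ∷ ys) → Rule b bs →
         Tableau V φ₀ (xs ++ map (b ++_) bs ++ ys)

Closed : Branch → Set
Closed b = ∃ λ σ → ∃ λ φ → ((σ , φ) ∈ b) × ((σ , ¬' φ) ∈ b)

ClosedTableau : List Branch → Set
ClosedTableau T = All Closed T

HasClosedTableau : Model → Formula → Set
HasClosedTableau V φ₀ = ∃ λ T → Tableau V φ₀ T × ClosedTableau T

module Submission where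

-- The argument is a truth lemma. Fix V and write V after σ for the model
-- reached from V by performing the assignments of the label σ in order. A
-- branch "knows the run at σ" if, for every variable p of φ₀, it contains
-- the literal at label σ giving the value of p in V after σ. The initial
-- branch knows the run at the empty label, and the frame rules RP1/RP2
-- together with the effect literals of R[α]/R⟨α⟩ let a branch learn the run
-- at σα from the run at σ. By induction on star-free φ: a branch that knows
-- the run at σ and contains ⟨σ,φ⟩ while φ is false there, or ⟨σ,¬φ⟩ while φ
-- is true there, is closable, i.e. closed by finitely many rule
-- applications. The cases use that satisfaction of star-free formulas is
-- decidable. Finally a closable branch is unfolded into a closed tableau.

open import Defs
open import Data.Bool using (Bool; true; false; if_then_else_)
open import Data.Product using (_×_; _,_; proj₁; proj₂; ∃)
open import Data.Sum using (_⊎_; inj₁; inj₂)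
open import Data.Empty using (⊥-elim)
open import Data.Nat using (_≟_)
open import Data.Maybe using (just; nothing)
open import Data.List using (List; []; _∷_; _++_; map; [_])
open import Data.List.Properties using (++-assoc; ++-identityʳ)
open import Data.List.Membership.Propositional using (_∈_; _∉_)
open import Data.List.Membership.Propositional.Properties using (∈-++⁺ˡ; ∈-++⁺ʳ; ∈-map⁺)
open import Data.List.Relation.Binary.Subset.Propositional using (_⊆_)
open import Data.List.Relation.Unary.Any using (here; there)
open import Data.List.Relation.Unary.All as All using (All; []; _∷_)
open import Data.List.Relation.Unary.All.Properties using (++⁺)
open import Function using (_∘_; id)
open import Function.Bundles using (_⇔_; mk⇔; Equivalence)
import Function.Properties.Equivalence as ⇔
open import Relation.Nullary using (¬_; Dec; yes; no)
open import Relation.Nullary.Decidable using (¬?; _×-dec_; _→-dec_; decidable-stable)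
  renaming (map to mapDec)
open import Relation.Binary.PropositionalEquality
  using (_≡_; refl; sym; trans; subst; cong; cong-app)

open Equivalence using (to; from)

lit : Bool → Var → Formula
lit v p = if v then var p else ¬' var p

effect∈ : ∀ σ α {p v} → (p , v) ∈ entries α → (σ ++ [ α ] , lit v p) ∈ effects σ α
effect∈ σ α {v = true}  p↦v = ∈-map⁺ _ p↦v
effect∈ σ α {v = false} p↦v = ∈-map⁺ _ p↦v

data UpdateView (W : Model) (α : Assignment) (p : Var) : Set where
  assigned  : ∀ {v} → (p , v) ∈ entries α → update W α p ≡ v → UpdateView W α p
  untouched : ¬ InDom p α → update W α p ≡ W p → UpdateView W α p

lookup-just : ∀ {p v} l → lookupE p l ≡ just v → (p , v) ∈ l
lookup-just {p} ((q , b) ∷ l) eq with p ≟ q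
lookup-just ((q , b) ∷ l) refl | yes refl = here refl
lookup-just ((q , b) ∷ l) eq   | no _     = there (lookup-just l eq)

lookup-nothing : ∀ {p v} l → lookupE p l ≡ nothing → (p , v) ∉ l
lookup-nothing {p} ((q , b) ∷ l) eq p↦v with p ≟ q
lookup-nothing ((q , b) ∷ l) () p↦v         | yes _
lookup-nothing ((q , b) ∷ l) eq (here refl) | no p≢q = p≢q refl
lookup-nothing ((q , b) ∷ l) eq (there p↦v) | no _   = lookup-nothing l eq p↦v

update-just : ∀ {W α p v} → lookupE p (entries α) ≡ just v → update W α p ≡ v
update-just eq rewrite eq = refl

update-nothing : ∀ {W α p} → lookupE p (entries α) ≡ nothing → update W α p ≡ W p
update-nothing eq rewrite eq = refl

updateView : ∀ W α p → UpdateView W α p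
updateView W α p with lookupE p (entries α) in eq
... | just v  = assigned (lookup-just (entries α) eq) (update-just {W} {α} eq)
... | nothing =
  untouched (λ (v , p↦v) → lookup-nothing (entries α) eq p↦v) (update-nothing {W} {α} eq)

_after_ : Model → Label → Model
W after []      = W
W after (α ∷ σ) = update W α after σ

after-snoc : ∀ W σ α → W after (σ ++ [ α ]) ≡ update (W after σ) α
after-snoc W []      α = refl
after-snoc W (β ∷ σ) α = after-snoc (update W β) σ α

-- Semantic clauses for boxes of star-free programs (the reduction axioms
-- of DL-PA); they drive both decidability and the truth lemma.
[asg]⇔ : ∀ W α φ → (W ⊨ ⟦ asg α ⟧ φ) ⇔ (update W α ⊨ φ)
[asg]⇔ W α φ = mk⇔ (λ h → h _ refl) (λ { h _ refl → h })

[⨟]⇔ : ∀ W π₁ π₂ φ → (W ⊨ ⟦ π₁ ⨟ π₂ ⟧ φ) ⇔ (W ⊨ ⟦ π₁ ⟧ ⟦ π₂ ⟧ φ)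
[⨟]⇔ W π₁ π₂ φ = mk⇔ (λ h U r₁ U' r₂ → h U' (U , r₁ , r₂)) (λ { h U' (U , r₁ , r₂) → h U r₁ U' r₂ })

[∪]⇔ : ∀ W π₁ π₂ φ → (W ⊨ ⟦ π₁ ∪' π₂ ⟧ φ) ⇔ ((W ⊨ ⟦ π₁ ⟧ φ) × (W ⊨ ⟦ π₂ ⟧ φ))
[∪]⇔ W π₁ π₂ φ = mk⇔ (λ h → (λ U r → h U (inj₁ r)) , (λ U r → h U (inj₂ r)))
           (λ { (h₁ , h₂) U (inj₁ r) → h₁ U r ; (h₁ , h₂) U (inj₂ r) → h₂ U r })

[?]⇔ : ∀ W ψ φ → (W ⊨ ⟦ ψ ¿ ⟧ φ) ⇔ (W ⊨ ψ → W ⊨ φ)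
[?]⇔ W ψ φ = mk⇔ (λ h w⊨ψ → h W (refl , w⊨ψ)) (λ { h _ (refl , w⊨ψ) → h w⊨ψ })

-- Satisfaction of a star-free formula is decidable; the truth lemma needs
-- this to reason classically about which subformula fails.
mutual
  ⊨-dec : ∀ φ → StarFree φ → ∀ W → Dec (W ⊨ φ)
  ⊨-dec (var p)   _        W with W p
  ... | true  = yes refl
  ... | false = no λ ()
  ⊨-dec (¬' φ)    sf       W = ¬? (⊨-dec φ sf W)
  ⊨-dec (φ ∧' ψ)  (sφ , sψ) W = ⊨-dec φ sφ W ×-dec ⊨-dec ψ sψ W
  ⊨-dec (⟦ π ⟧ φ) (sπ , sφ) W = box-dec π sπ φ (⊨-dec φ sφ) W

  box-dec : ∀ π → StarFreeP π → ∀ φ → (∀ W → Dec (W ⊨ φ)) → ∀ W → Dec (W ⊨ ⟦ π ⟧ φ)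
  box-dec (asg α)    _         φ φ? W = mapDec (⇔.sym ([asg]⇔ W α φ)) (φ? (update W α))
  box-dec (π₁ ⨟ π₂)  (s₁ , s₂) φ φ? W =
    mapDec (⇔.sym ([⨟]⇔ W π₁ π₂ φ)) (box-dec π₁ s₁ (⟦ π₂ ⟧ φ) (box-dec π₂ s₂ φ φ?) W)
  box-dec (π₁ ∪' π₂) (s₁ , s₂) φ φ? W =
    mapDec (⇔.sym ([∪]⇔ W π₁ π₂ φ)) (box-dec π₁ s₁ φ φ? W ×-dec box-dec π₂ s₂ φ φ? W)
  box-dec (ψ ¿)      sψ        φ φ? W = mapDec (⇔.sym ([?]⇔ W ψ φ)) (⊨-dec ψ sψ W →-dec φ? W)

¬×-split : ∀ {A B : Set} → Dec A → ¬ (A × B) → ¬ A ⊎ ¬ B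
¬×-split (yes a) ¬ab = inj₂ λ b → ¬ab (a , b)
¬×-split (no ¬a) _   = inj₁ ¬a

¬→-split : ∀ {A B : Set} → Dec A → ¬ (A → B) → A × ¬ B
¬→-split (yes a) ¬a→b = a , λ b → ¬a→b λ _ → b
¬→-split (no ¬a) ¬a→b = ⊥-elim (¬a→b λ a → ⊥-elim (¬a a))

data Closable (b : Branch) : Set where
  closed : Closed b → Closable b
  expand : ∀ {bs} → Rule b bs → All (λ c → Closable (b ++ c)) bs → Closable b

expand₁ : ∀ {b c} → Rule b [ c ] → Closable (b ++ c) → Closable b
expand₁ r cl = expand r (cl ∷ [])

expand₂ : ∀ {b c d} → Rule b (c ∷ d ∷ []) → Closable (b ++ c) → Closable (b ++ d) → Closable b
expand₂ r cl₁ cl₂ = expand r (cl₁ ∷ cl₂ ∷ [])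

added₁ : ∀ (b : Branch) {x c} → x ∈ b ++ x ∷ c
added₁ b = ∈-++⁺ʳ b (here refl)

added₂ : ∀ (b : Branch) {x y c} → y ∈ b ++ x ∷ y ∷ c
added₂ b = ∈-++⁺ʳ b (there (here refl))

frame : ∀ {b σ α p ψ} v → (σ , lit v p) ∈ b → (σ ++ [ α ] , ψ) ∈ b → ¬ InDom p α →
        Rule b [ [ (σ ++ [ α ] , lit v p) ] ]
frame true  = RP1
frame false = RP2

module TruthLemma (V : Model) (S : List Var) where

  Records : Label → Branch → Var → Set
  Records σ b p = (σ , lit ((V after σ) p) p) ∈ b

  Knows : Label → Branch → Set
  Knows σ b = All (Records σ b) S

  grow : ∀ {σ b} c → Knows σ b → Knows σ (b ++ c)
  grow c = All.map ∈-++⁺ˡ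

  recorded : ∀ {σ b p v} → (V after σ) p ≡ v → (σ , lit v p) ∈ b → Records σ b p
  recorded {σ} {b} {p} eq = subst (λ v → (σ , lit v p) ∈ b) (sym eq)

  -- If b records p at σ, contains the effects of α and some formula at σα,
  -- then b is closable as soon as its extensions recording p at σα are:
  -- either α sets p (the effect literal is already there) or the frame
  -- rule copies the literal of p from σ to σα.
  inheritOne : ∀ {σ α ψ b p} → Records σ b p → effects σ α ⊆ b → (σ ++ [ α ] , ψ) ∈ b →
               (∀ {b'} → b ⊆ b' → Records (σ ++ [ α ]) b' p → Closable b') → Closable b
  inheritOne {σ} {α} {ψ} {b} {p} rec eff m k with updateView (V after σ) α p
  ... | assigned p↦v eq =
    k id (recorded (trans (cong-app (after-snoc V σ α) p) eq) (eff (effect∈ σ α p↦v)))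
  ... | untouched p∉α eq =
    expand₁ (frame _ rec m p∉α)
            (k ∈-++⁺ˡ (recorded (trans (cong-app (after-snoc V σ α) p) eq) (added₁ b)))

  inherit : ∀ {σ α ψ b} T → All (Records σ b) T → effects σ α ⊆ b → (σ ++ [ α ] , ψ) ∈ b →
            (∀ {b'} → b ⊆ b' → All (Records (σ ++ [ α ]) b') T → Closable b') → Closable b
  inherit []      []           eff m k = k id []
  inherit (p ∷ T) (rec ∷ recs) eff m k =
    inheritOne rec eff m λ b⊆b' rec' →
    inherit T (All.map b⊆b' recs) (b⊆b' ∘ eff) (b⊆b' m) λ b'⊆b'' recs' →
    k (b'⊆b'' ∘ b⊆b') (b'⊆b'' rec' ∷ recs')

  afterAssignment : ∀ {σ α χ b} → Knows σ b →
                    (∀ {b'} → Knows (σ ++ [ α ]) b' → (σ ++ [ α ] , χ) ∈ b' → Closable b') →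
                    Closable (b ++ (σ ++ [ α ] , χ) ∷ effects σ α)
  afterAssignment {b = b} k cl =
    inherit S (grow _ k) (∈-++⁺ʳ b ∘ there) (added₁ b) λ b⊆b' k' → cl k' (b⊆b' (added₁ b))

  ClosesIfFalse ClosesIfTrue Faithful : Formula → Set
  ClosesIfFalse φ = ∀ {σ b} → Knows σ b → (σ , φ) ∈ b → ¬ (V after σ ⊨ φ) → Closable b
  ClosesIfTrue  φ = ∀ {σ b} → Knows σ b → (σ , ¬' φ) ∈ b → V after σ ⊨ φ → Closable b
  Faithful φ = ClosesIfFalse φ × ClosesIfTrue φ

  mutual
    faithful : ∀ φ → StarFree φ → vars φ ⊆ S → Faithful φ
    faithful (var p) _ vars⊆S = pos , neg
      where
      pos : ClosesIfFalse (var p)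
      pos {σ} k p∈b p-false with (V after σ) p | All.lookup k (vars⊆S (here refl))
      ... | true  | _    = ⊥-elim (p-false refl)
      ... | false | ¬p∈b = closed (σ , var p , p∈b , ¬p∈b)
      neg : ClosesIfTrue (var p)
      neg {σ} k ¬p∈b p-true with (V after σ) p | All.lookup k (vars⊆S (here refl))
      neg {σ} k ¬p∈b refl | true | p∈b = closed (σ , var p , p∈b , ¬p∈b)
    faithful (¬' φ) sφ vars⊆S = pos , neg
      where
      IH = faithful φ sφ vars⊆S
      pos : ClosesIfFalse (¬' φ)
      pos {σ} k m ¬¬φ = proj₂ IH k m (decidable-stable (⊨-dec φ sφ (V after σ)) ¬¬φ)
      neg : ClosesIfTrue (¬' φ)
      neg {b = b} k m φ-true = expand₁ (R¬ m) (proj₁ IH (grow _ k) (added₁ b) φ-true)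
    faithful (φ ∧' ψ) (sφ , sψ) vars⊆S = pos , neg
      where
      IHφ = faithful φ sφ (vars⊆S ∘ ∈-++⁺ˡ)
      IHψ = faithful ψ sψ (vars⊆S ∘ ∈-++⁺ʳ (vars φ))
      pos : ClosesIfFalse (φ ∧' ψ)
      pos {σ} {b} k m ¬φ∧ψ with ¬×-split (⊨-dec φ sφ (V after σ)) ¬φ∧ψ
      ... | inj₁ ¬φ = expand₁ (R∧ m) (proj₁ IHφ (grow _ k) (added₁ b) ¬φ)
      ... | inj₂ ¬ψ = expand₁ (R∧ m) (proj₁ IHψ (grow _ k) (added₂ b) ¬ψ)
      neg : ClosesIfTrue (φ ∧' ψ)
      neg {b = b} k m (φ-true , ψ-true) =
        expand₂ (R∨ m) (proj₂ IHφ (grow _ k) (added₁ b) φ-true)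
                       (proj₂ IHψ (grow _ k) (added₁ b) ψ-true)
    faithful (⟦ π ⟧ φ) (sπ , sφ) vars⊆S =
      faithfulBox π sπ (vars⊆S ∘ ∈-++⁺ˡ) φ
        (faithful φ sφ (vars⊆S ∘ ∈-++⁺ʳ (varsP π))) (⊨-dec φ sφ)

    faithfulBox : ∀ π → StarFreeP π → varsP π ⊆ S → ∀ φ → Faithful φ →
                  (∀ W → Dec (W ⊨ φ)) → Faithful (⟦ π ⟧ φ)
    faithfulBox (asg α) _ _ φ IH _ = pos , neg
      where
      pos : ClosesIfFalse (⟦ asg α ⟧ φ)
      pos {σ} k m ¬box = expand₁ (R[α] m) (afterAssignment k λ k' m' →
        proj₁ IH k' m' (¬box ∘ from ([asg]⇔ (V after σ) α φ) ∘ subst (_⊨ φ) (after-snoc V σ α)))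
      neg : ClosesIfTrue (⟦ asg α ⟧ φ)
      neg {σ} k m box = expand₁ (R⟨α⟩ m) (afterAssignment k λ k' m' →
        proj₂ IH k' m' (subst (_⊨ φ) (sym (after-snoc V σ α)) (to ([asg]⇔ (V after σ) α φ) box)))
    faithfulBox (π₁ ⨟ π₂) (s₁ , s₂) vars⊆S φ IH φ? = pos , neg
      where
      IH₂ = faithfulBox π₂ s₂ (vars⊆S ∘ ∈-++⁺ʳ (varsP π₁)) φ IH φ?
      IH₁ = faithfulBox π₁ s₁ (vars⊆S ∘ ∈-++⁺ˡ) (⟦ π₂ ⟧ φ) IH₂ (box-dec π₂ s₂ φ φ?)
      pos : ClosesIfFalse (⟦ π₁ ⨟ π₂ ⟧ φ)
      pos {σ} {b} k m ¬box = expand₁ (R[⨟] m)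
        (proj₁ IH₁ (grow _ k) (added₁ b) (¬box ∘ from ([⨟]⇔ (V after σ) π₁ π₂ φ)))
      neg : ClosesIfTrue (⟦ π₁ ⨟ π₂ ⟧ φ)
      neg {σ} {b} k m box = expand₁ (R⟨⨟⟩ m)
        (proj₂ IH₁ (grow _ k) (added₁ b) (to ([⨟]⇔ (V after σ) π₁ π₂ φ) box))
    faithfulBox (π₁ ∪' π₂) (s₁ , s₂) vars⊆S φ IH φ? = pos , neg
      where
      IH₁ = faithfulBox π₁ s₁ (vars⊆S ∘ ∈-++⁺ˡ) φ IH φ?
      IH₂ = faithfulBox π₂ s₂ (vars⊆S ∘ ∈-++⁺ʳ (varsP π₁)) φ IH φ?
      pos : ClosesIfFalse (⟦ π₁ ∪' π₂ ⟧ φ)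
      pos {σ} {b} k m ¬box
        with ¬×-split (box-dec π₁ s₁ φ φ? (V after σ)) (¬box ∘ from ([∪]⇔ (V after σ) π₁ π₂ φ))
      ... | inj₁ ¬box₁ = expand₁ (R[∪] m) (proj₁ IH₁ (grow _ k) (added₁ b) ¬box₁)
      ... | inj₂ ¬box₂ = expand₁ (R[∪] m) (proj₁ IH₂ (grow _ k) (added₂ b) ¬box₂)
      neg : ClosesIfTrue (⟦ π₁ ∪' π₂ ⟧ φ)
      neg {σ} {b} k m box with to ([∪]⇔ (V after σ) π₁ π₂ φ) box
      ... | box₁ , box₂ = expand₂ (R⟨∪⟩ m) (proj₂ IH₁ (grow _ k) (added₁ b) box₁)
                                            (proj₂ IH₂ (grow _ k) (added₁ b) box₂)
    faithfulBox (π *) () _ _ _ _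
    faithfulBox (ψ ¿) sψ vars⊆S φ IH φ? = pos , neg
      where
      IHψ = faithful ψ sψ vars⊆S
      pos : ClosesIfFalse (⟦ ψ ¿ ⟧ φ)
      pos {σ} {b} k m ¬box
        with ¬→-split (⊨-dec ψ sψ (V after σ)) (¬box ∘ from ([?]⇔ (V after σ) ψ φ))
      ... | ψ-true , ¬φ = expand₂ (R[?] m) (proj₂ IHψ (grow _ k) (added₁ b) ψ-true)
                                            (proj₁ IH (grow _ k) (added₁ b) ¬φ)
      neg : ClosesIfTrue (⟦ ψ ¿ ⟧ φ)
      neg {σ} {b} k m box with ⊨-dec ψ sψ (V after σ)
      ... | no ¬ψ      = expand₁ (R⟨?⟩ m) (proj₁ IHψ (grow _ k) (added₁ b) ¬ψ)
      ... | yes ψ-true = expand₁ (R⟨?⟩ m)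
        (proj₂ IH (grow _ k) (added₂ b) (to ([?]⇔ (V after σ) ψ φ) box ψ-true))

module Unfolding (V : Model) (φ₀ : Formula) where

  ClosedInPlace : List Branch → List Branch → Set
  ClosedInPlace xs ys = ∃ λ zs → Tableau V φ₀ (xs ++ zs ++ ys) × All Closed zs

  mutual
    unfold : ∀ xs {b} ys → Tableau V φ₀ (xs ++ b ∷ ys) → Closable b → ClosedInPlace xs ys
    unfold xs ys t (closed c)     = [ _ ] , t , c ∷ []
    unfold xs ys t (expand r cls) = unfoldChildren xs ys (step t r) cls

    unfoldChildren : ∀ xs {b bs} ys → Tableau V φ₀ (xs ++ map (b ++_) bs ++ ys) →
                     All (λ c → Closable (b ++ c)) bs → ClosedInPlace xs ys
    unfoldChildren xs ys t [] = [] , t , []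
    unfoldChildren xs {b} {c ∷ cs} ys t (cl ∷ cls)
      with unfold xs (map (b ++_) cs ++ ys) t cl
    ... | zs₁ , t₁ , closed₁
      with unfoldChildren (xs ++ zs₁) ys (subst (Tableau V φ₀) (sym (++-assoc xs zs₁ _)) t₁) cls
    ... | zs₂ , t₂ , closed₂ =
      zs₁ ++ zs₂ , subst (Tableau V φ₀) (regroup zs₁ zs₂) t₂ , ++⁺ closed₁ closed₂
      where
      regroup : ∀ zs₁ zs₂ → (xs ++ zs₁) ++ zs₂ ++ ys ≡ xs ++ (zs₁ ++ zs₂) ++ ys
      regroup zs₁ zs₂ = trans (++-assoc xs zs₁ (zs₂ ++ ys)) (cong (xs ++_) (sym (++-assoc zs₁ zs₂ ys)))

initialKnows : ∀ V φ₀ → TruthLemma.Knows V (vars φ₀) [] (initBranch V φ₀)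
initialKnows V φ₀ = All.tabulate λ p∈φ₀ → ∈-++⁺ˡ (∈-map⁺ _ p∈φ₀)

initialClosable : ∀ V φ₀ → StarFree φ₀ → ¬ (V ⊨ φ₀) → Closable (initBranch V φ₀)
initialClosable V φ₀ sf fails =
  proj₁ (faithful φ₀ sf id) (initialKnows V φ₀) (∈-++⁺ʳ _ (here refl)) fails
  where open TruthLemma V (vars φ₀)

closedTableau : ∀ V φ₀ → Closable (initBranch V φ₀) → HasClosedTableau V φ₀
closedTableau V φ₀ cl with Unfolding.unfold V φ₀ [] [] init cl
... | zs , t , allClosed = zs , subst (Tableau V φ₀) (++-identityʳ zs) t , allClosed

theorem2 : (V : Model) (φ₀ : Formula) → StarFree φ₀ →
           ¬ HasClosedTableau V φ₀ → V ⊨ φ₀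
theorem2 V φ₀ sf noClosedTableau =
  decidable-stable (⊨-dec φ₀ sf V) (noClosedTableau ∘ closedTableau V φ₀ ∘ initialClosable V φ₀ sf)
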